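{- Fix a signature and isdef-formulas $\delta$ on it, and let $\models$ denote logical consequence relative to $\delta$. (1) For every term $t$: $\{\mathrm{Def}(t)\}\models(t=t)$. (2) Let $\varphi(x_1,\dots,x_n)$ be a formula with distinct variable symbols $x_1,\dots,x_n$, let $1\le i\le n$, and let $t_1,\dots,t_n$ and $t'_i$ be terms such that $t_i$ and $t'_i$ are free for $x_i$ in $\varphi(x_1,\dots,x_n)$. Then $\{(t_i=t'_i),\ \varphi(t_1,\dots,t_n)\}\models\varphi(t_1,\dots,t_{i-1},t'_i,t_{i+1},\dots,t_n)$.
   Context: Syntax: a signature has countable sets of constant, function and relation symbols with positive integer arities; variables $\mathtt{v}_1,\mathtt{v}_2,\dots$. Terms: variables, constants, $f(t_1,\dots,t_n)$. Atomic formulas: $\mathsf{F}$, $\mathsf{T}$, $(t_1=t_2)$, $R(t_1,\dots,t_n)$. Formulas use $\neg,\wedge,\vee,\forall x,\exists x$ only; $\wedge,\vee$ associate to the left. $\varphi(t_1,\dots,t_n)$ denotes the result of replacing the free occurrences of each $x_j$ in $\varphi(x_1,\dots,x_n)$ by $t_j$; a term $t$ is free for $x$ in $\varphi$ if no variable of $t$ becomes bound by the substitution. Semantics: a structure has nonempty domain $\mathbb{D}$, elements for constants, partial functions $\mathbb{D}^n\to\mathbb{D}$ for function symbols, subsets of $\mathbb{D}^n$ for relation symbols; assignments $\nu:\mathbb{Z}^+\to\mathbb{D}$ with $\nu(\mathtt{v}_i)=\nu(i)$. A compound term is defined iff all arguments are defined and the function is defined at their values. Truth values in $\{\mathsf{F},\mathsf{U},\mathsf{T}\}$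 ordered $\mathsf{F}<\mathsf{U}<\mathsf{T}$: equality/relation atoms are $\mathsf{U}$ if some argument is undefined, else classical; $\neg$ swaps $\mathsf{F},\mathsf{T}$, fixes $\mathsf{U}$; $\wedge$ min, $\vee$ max; $\forall x$ min, $\exists x$ max over all values of $x$ in $\mathbb{D}$. Isdef-formulas: for each $n$-ary function symbol $f$ a formula $\delta_f$ with free variables among $\mathtt{v}_1,\dots,\mathtt{v}_n$, such that $\delta_g$ is literally $\mathsf{T}$ for every function symbol $g$ in $\delta_f$. $\sigma\models\delta$ iff for all $f$, $d_1,\dots,d_n\in\mathbb{D}$: $\delta_f$ is $\mathsf{T}$ when $\mathtt{v}_i\mapsto d_i$ iff $f$ is defined at $(d_1,\dots,d_n)$. A model of $(\delta,\Gamma)$ is $(\sigma,\nu)$ with $\sigma\models\delta$ and all of $\Gamma$ true under $(\sigma,\nu)$; $\Gamma\models\varphi$ iff every model of $(\delta,\Gamma)$ makes $\varphi$ true ($\mathsf{T}$). $\mathrm{Def}$ on terms: $\mathrm{Def}(x)=\mathrm{Def}(c)=\mathsf{T}$; $\mathrm{Def}(f(t_1,\dots,t_n))=\mathrm{Def}(t_1)\wedge\cdots\wedge\mathrm{Def}(t_n)\wedge\delta_f(t_1,\dots,t_n)$, where $\delta_f(t_1,\dots,t_n)$ is $\delta_f$ with bound variables renamed so each $t_i$ is free for $\mathtt{v}_i$, then $t_i$ substituted for free $\mathtt{v}_i$. -}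

module Defs where

open import Data.Nat using (ℕ; zero; suc; _+_; _<_; _⊔_; _≟_; _<?_)
open import Data.Fin using (Fin; toℕ; fromℕ<)
open import Data.Vec using (Vec; []; _∷_; tabulate; lookup)
open import Data.Vec.Relation.Unary.Any using (Any)
open import Data.List using (List; []; _∷_; _++_; [_])
open import Data.List.Relation.Unary.All using (All)
open import Data.Maybe using (Maybe; just; nothing)
open import Data.Product using (Σ; _×_; _,_)
open import Data.Sum using (_⊎_)
open import Data.Empty using (⊥)
open import Data.Unit using (⊤)
open import Relation.Nullary using (¬_; yes; no)
open import Relation.Binary.PropositionalEquality using (_≡_; _≢_)
open import Function.Definitions using (Injective)

-- Variables: the variable v_{k+1} of the paper is represented by k : ℕ.

record Signature : Set₁ where
  field
    Con Fun Rel : Set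
    funAr : Fun → ℕ
    relAr : Rel → ℕ
    funAr-pos : ∀ f → 0 < funAr f
    relAr-pos : ∀ r → 0 < relAr r
    -- countability
    conCode : Con → ℕ
    conCode-inj : Injective _≡_ _≡_ conCode
    funCode : Fun → ℕ
    funCode-inj : Injective _≡_ _≡_ funCode
    relCode : Rel → ℕ
    relCode-inj : Injective _≡_ _≡_ relCode

open Signature public

Var : Set
Var = ℕ

module _ (S : Signature) where

  data Term : Set where
    var : Var → Term
    con : Con S → Term
    app : (f : Fun S) → Vec Term (funAr S f) → Term

  data Formula : Set where
    ⊥F ⊤F : Formula
    _≐_ : Term → Term → Formula
    rel : (r : Rel S) → Vec Term (relAr S r) → Formula
    ¬F_ : Formula → Formula
    _∧F_ _∨F_ : Formula → Formula → Formula
    ∀F ∃F : Var → Formula → Formula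

  infixl 6 _∧F_ _∨F_

module _ {S : Signature} where

  data OccT (x : Var) : Term S → Set where
    here  : OccT x (var x)
    inApp : ∀ {f ts} → Any (OccT x) ts → OccT x (app f ts)

  FreeIn : Var → Formula S → Set
  FreeIn x ⊥F = ⊥
  FreeIn x ⊤F = ⊥
  FreeIn x (t ≐ u) = OccT x t ⊎ OccT x u
  FreeIn x (rel r ts) = Any (OccT x) ts
  FreeIn x (¬F φ) = FreeIn x φ
  FreeIn x (φ ∧F ψ) = FreeIn x φ ⊎ FreeIn x ψ
  FreeIn x (φ ∨F ψ) = FreeIn x φ ⊎ FreeIn x ψ
  FreeIn x (∀F y φ) = x ≢ y × FreeIn x φ
  FreeIn x (∃F y φ) = x ≢ y × FreeIn x φ

  data FunOccT (g : Fun S) : Term S → Set where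
    head  : ∀ {ts} → FunOccT g (app g ts)
    inArg : ∀ {f ts} → Any (FunOccT g) ts → FunOccT g (app f ts)

  FunOcc : Fun S → Formula S → Set
  FunOcc g ⊥F = ⊥
  FunOcc g ⊤F = ⊥
  FunOcc g (t ≐ u) = FunOccT g t ⊎ FunOccT g u
  FunOcc g (rel r ts) = Any (FunOccT g) ts
  FunOcc g (¬F φ) = FunOcc g φ
  FunOcc g (φ ∧F ψ) = FunOcc g φ ⊎ FunOcc g ψ
  FunOcc g (φ ∨F ψ) = FunOcc g φ ⊎ FunOcc g ψ
  FunOcc g (∀F y φ) = FunOcc g φ
  FunOcc g (∃F y φ) = FunOcc g φ

  FreeFor : Term S → Var → Formula S → Set
  FreeFor t x (¬F φ) = FreeFor t x φ
  FreeFor t x (φ ∧F ψ) = FreeFor t x φ × FreeFor t x ψ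
  FreeFor t x (φ ∨F ψ) = FreeFor t x φ × FreeFor t x ψ
  FreeFor t x (∀F y φ) = x ≡ y ⊎ ((FreeIn x φ → ¬ OccT y t) × FreeFor t x φ)
  FreeFor t x (∃F y φ) = x ≡ y ⊎ ((FreeIn x φ → ¬ OccT y t) × FreeFor t x φ)
  FreeFor t x _ = ⊤

  -- Substitution (plain textual replacement of free occurrences)

  Subst : Set
  Subst = Var → Term S

  _[_↦_] : Subst → Var → Term S → Subst
  (σ [ y ↦ t ]) z with z ≟ y
  ... | yes _ = t
  ... | no  _ = σ z

  mutual
    subT : Subst → Term S → Term S
    subT σ (var x) = σ x
    subT σ (con c) = con c
    subT σ (app f ts) = app f (subTs σ ts)

    subTs : ∀ {n} → Subst → Vec (Term S) n → Vec (Term S) n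
    subTs σ [] = []
    subTs σ (t ∷ ts) = subT σ t ∷ subTs σ ts

  subF : Subst → Formula S → Formula S
  subF σ ⊥F = ⊥F
  subF σ ⊤F = ⊤F
  subF σ (t ≐ u) = subT σ t ≐ subT σ u
  subF σ (rel r ts) = rel r (subTs σ ts)
  subF σ (¬F φ) = ¬F subF σ φ
  subF σ (φ ∧F ψ) = subF σ φ ∧F subF σ ψ
  subF σ (φ ∨F ψ) = subF σ φ ∨F subF σ ψ
  subF σ (∀F y φ) = ∀F y (subF (σ [ y ↦ var y ]) φ)
  subF σ (∃F y φ) = ∃F y (subF (σ [ y ↦ var y ]) φ)

  mkSub : ∀ {n} → Vec Var n → Vec (Term S) n → Subst
  mkSub [] [] y = var y
  mkSub (x ∷ xs) (t ∷ ts) y with y ≟ x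
  ... | yes _ = t
  ... | no  _ = mkSub xs ts y

  _⟪_≔_⟫ : ∀ {n} → Formula S → Vec Var n → Vec (Term S) n → Formula S
  φ ⟪ xs ≔ ts ⟫ = subF (mkSub xs ts) φ

  Ren : Set
  Ren = Var → Var

  _[_⇒_]ʳ : Ren → Var → Var → Ren
  (ρ [ y ⇒ z ]ʳ) w with w ≟ y
  ... | yes _ = z
  ... | no  _ = ρ w

  mutual
    renT : Ren → Term S → Term S
    renT ρ (var x) = var (ρ x)
    renT ρ (con c) = con c
    renT ρ (app f ts) = app f (renTs ρ ts)

    renTs : ∀ {n} → Ren → Vec (Term S) n → Vec (Term S) n
    renTs ρ [] = []
    renTs ρ (t ∷ ts) = renT ρ t ∷ renTs ρ ts

  renBound : ℕ → Ren → Formula S → Formula S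
  renBound N ρ ⊥F = ⊥F
  renBound N ρ ⊤F = ⊤F
  renBound N ρ (t ≐ u) = renT ρ t ≐ renT ρ u
  renBound N ρ (rel r ts) = rel r (renTs ρ ts)
  renBound N ρ (¬F φ) = ¬F renBound N ρ φ
  renBound N ρ (φ ∧F ψ) = renBound N ρ φ ∧F renBound N ρ ψ
  renBound N ρ (φ ∨F ψ) = renBound N ρ φ ∨F renBound N ρ ψ
  renBound N ρ (∀F y φ) = ∀F (y + N) (renBound N (ρ [ y ⇒ y + N ]ʳ) φ)
  renBound N ρ (∃F y φ) = ∃F (y + N) (renBound N (ρ [ y ⇒ y + N ]ʳ) φ)

  mutual
    maxT : Term S → ℕ
    maxT (var x) = x
    maxT (con c) = 0
    maxT (app f ts) = maxTs ts

    maxTs : ∀ {n} → Vec (Term S) n → ℕ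
    maxTs [] = 0
    maxTs (t ∷ ts) = maxT t ⊔ maxTs ts

  maxF : Formula S → ℕ
  maxF ⊥F = 0
  maxF ⊤F = 0
  maxF (t ≐ u) = maxT t ⊔ maxT u
  maxF (rel r ts) = maxTs ts
  maxF (¬F φ) = maxF φ
  maxF (φ ∧F ψ) = maxF φ ⊔ maxF ψ
  maxF (φ ∨F ψ) = maxF φ ⊔ maxF ψ
  maxF (∀F y φ) = y ⊔ maxF φ
  maxF (∃F y φ) = y ⊔ maxF φ

  -- substitution v_i := t_i (i.e. k := t_{k+1}) for k < n
  argSub : ∀ {n} → Vec (Term S) n → Subst
  argSub {n} ts k with k <? n
  ... | yes k<n = lookup ts (fromℕ< k<n)
  ... | no  _   = var k

  -- ψ(t_1,…,t_n): bound variables renamed apart from all variables of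
  -- ψ and of the t_i, then t_i substituted for free v_i.
  instantiate : ∀ {n} → Formula S → Vec (Term S) n → Formula S
  instantiate ψ ts =
    subF (argSub ts) (renBound (suc (maxF ψ ⊔ maxTs ts)) (λ x → x) ψ)

  conjL : Formula S → List (Formula S) → Formula S
  conjL a [] = a
  conjL a (b ∷ bs) = conjL (a ∧F b) bs

  bigAnd : List (Formula S) → Formula S
  bigAnd [] = ⊤F
  bigAnd (a ∷ as) = conjL a as

  record Structure : Set₁ where
    field
      D : Set
      d₀ : D                                          -- nonempty
      conI : Con S → D
      funI : (f : Fun S) → Vec D (funAr S f) → Maybe D
      relI : (r : Rel S) → Vec D (relAr S r) → Set

  open Structure public

  module _ (M : Structure) where

    Assign : Set
    Assign = Var → D M

    _[_≔ᵃ_] : Assign → Var → D M → Assign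
    (ν [ y ≔ᵃ d ]) z with z ≟ y
    ... | yes _ = d
    ... | no  _ = ν z

    _>>=ᵐ_ : ∀ {A B : Set} → Maybe A → (A → Maybe B) → Maybe B
    just a >>=ᵐ k = k a
    nothing >>=ᵐ k = nothing

    mutual
      evalT : Assign → Term S → Maybe (D M)
      evalT ν (var x) = just (ν x)
      evalT ν (con c) = just (conI M c)
      evalT ν (app f ts) = evalTs ν ts >>=ᵐ funI M f

      evalTs : ∀ {n} → Assign → Vec (Term S) n → Maybe (Vec (D M) n)
      evalTs ν [] = just []
      evalTs ν (t ∷ ts) =
        evalT ν t >>=ᵐ λ d → evalTs ν ts >>=ᵐ λ ds → just (d ∷ ds)

    -- IsT φ ν : φ has value T;  IsF φ ν : φ has value F
    -- (value U = neither).
    mutual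
      IsT : Formula S → Assign → Set
      IsT ⊥F ν = ⊥
      IsT ⊤F ν = ⊤
      IsT (t ≐ u) ν = Σ (D M) λ d → Σ (D M) λ e →
        evalT ν t ≡ just d × evalT ν u ≡ just e × d ≡ e
      IsT (rel r ts) ν = Σ (Vec (D M) (relAr S r)) λ ds →
        evalTs ν ts ≡ just ds × relI M r ds
      IsT (¬F φ) ν = IsF φ ν
      IsT (φ ∧F ψ) ν = IsT φ ν × IsT ψ ν
      IsT (φ ∨F ψ) ν = IsT φ ν ⊎ IsT ψ ν
      IsT (∀F x φ) ν = (d : D M) → IsT φ (ν [ x ≔ᵃ d ])
      IsT (∃F x φ) ν = Σ (D M) λ d → IsT φ (ν [ x ≔ᵃ d ])

      IsF : Formula S → Assign → Set
      IsF ⊥F ν = ⊤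
      IsF ⊤F ν = ⊥
      IsF (t ≐ u) ν = Σ (D M) λ d → Σ (D M) λ e →
        evalT ν t ≡ just d × evalT ν u ≡ just e × d ≢ e
      IsF (rel r ts) ν = Σ (Vec (D M) (relAr S r)) λ ds →
        evalTs ν ts ≡ just ds × ¬ relI M r ds
      IsF (¬F φ) ν = IsT φ ν
      IsF (φ ∧F ψ) ν = IsF φ ν ⊎ IsF ψ ν
      IsF (φ ∨F ψ) ν = IsF φ ν × IsF ψ ν
      IsF (∀F x φ) ν = Σ (D M) λ d → IsF φ (ν [ x ≔ᵃ d ])
      IsF (∃F x φ) ν = (d : D M) → IsF φ (ν [ x ≔ᵃ d ])

  record Isdef : Set where
    field
      δ : (f : Fun S) → Formula S
      δ-free : ∀ f x → FreeIn x (δ f) → x < funAr S f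
      δ-inner : ∀ f g → FunOcc g (δ f) → δ g ≡ ⊤F

  open Isdef public

  Defined : (M : Structure) (f : Fun S) → Vec (D M) (funAr S f) → Set
  Defined M f ds = Σ (D M) λ d → funI M f ds ≡ just d

  -- σ ⊨ δ  (v_i ↦ d_i, i.e. variable k ↦ ν k for k < n)
  _⊨δ_ : Structure → Isdef → Set
  M ⊨δ Δ = ∀ (f : Fun S) (ν : Assign M) →
    (IsT M (δ Δ f) ν → Defined M f (tabulate (λ i → ν (toℕ i))))
    × (Defined M f (tabulate (λ i → ν (toℕ i))) → IsT M (δ Δ f) ν)

  Consequence : Isdef → List (Formula S) → Formula S → Set₁
  Consequence Δ Γ φ = ∀ (M : Structure) → M ⊨δ Δ → (ν : Assign M) →
    All (λ γ → IsT M γ ν) Γ → IsT M φ ν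

  module _ (Δ : Isdef) where
    mutual
      Def : Term S → Formula S
      Def (var x) = ⊤F
      Def (con c) = ⊤F
      Def (app f ts) = bigAnd (Defs ts ++ [ instantiate (δ Δ f) ts ])

      Defs : ∀ {n} → Vec (Term S) n → List (Formula S)
      Defs [] = []
      Defs (t ∷ ts) = Def t ∷ Defs ts

{-# OPTIONS --safe #-}
-- (1) Def t is true only where every subterm of t is defined: in its conjunct
-- δ_f(t_1,…,t_n) the bound variables of δ_f are shifted above every variable
-- in sight, so it takes the value of δ_f under v_i ↦ ⟦t_i⟧, and the
-- isdef-condition turns truth of δ_f into definedness of f.
-- (2) Substituting t_i or t′_i for x_i gives every atom the same value once
-- t_i and t′_i have the same value, and freeness for x_i keeps quantifiers
-- from capturing their variables; so each definite truth value of
-- φ(…,t_i,…) is also one of φ(…,t′_i,…).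
module Submission where

open import Defs
open import Data.Nat using (ℕ; suc; _<_; _≤_; _⊔_; _+_; _≟_; _<?_; s≤s)
open import Data.Nat.Properties using (≤-refl; m≤n⇒m≤n⊔o; m≤n⇒m≤o⊔n; +-cancelʳ-≡; m+n≮n)
open import Data.Fin using (Fin; zero; suc; toℕ; fromℕ<)
open import Data.Fin.Properties using (fromℕ<-toℕ; toℕ<n; suc-injective)
open import Data.Vec using (Vec; []; _∷_; lookup; tabulate; _[_]≔_)
open import Data.Vec.Properties using (tabulate-cong; tabulate∘lookup; lookup∘update)
open import Data.Vec.Relation.Unary.Any using (Any; here; there)
open import Data.Vec.Membership.Propositional using (lose)
open import Data.Vec.Membership.Propositional.Properties using (∈-lookup)
open import Data.List using (List; []; _∷_; _++_; [_])
open import Data.List.Relation.Unary.All using (All; []; _∷_)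
open import Data.List.Relation.Unary.All.Properties using (++⁻)
open import Data.Maybe using (Maybe; just)
open import Data.Product using (∃; _×_; _,_; proj₁; proj₂)
open import Data.Sum using (_⊎_; inj₁; inj₂; fromInj₂)
open import Function using (id)
open import Function.Definitions using (Injective)
open import Relation.Nullary using (¬_; Dec; yes; no; contradiction)
open import Relation.Binary.PropositionalEquality
  using (_≡_; _≢_; refl; sym; trans; cong; subst; subst₂; module ≡-Reasoning)

module Syntax {S : Signature} where

  ↦-here : (σ : Subst {S}) (y : Var) (t : Term S) → (σ [ y ↦ t ]) y ≡ t
  ↦-here σ y t with y ≟ y
  ... | yes _ = refl
  ... | no y≢y = contradiction refl y≢y

  ↦-there : (σ : Subst {S}) {y z : Var} (t : Term S) → z ≢ y → (σ [ y ↦ t ]) z ≡ σ z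
  ↦-there σ {y} {z} t z≢y with z ≟ y
  ... | yes z≡y = contradiction z≡y z≢y
  ... | no _ = refl

  ↦-cong : {σ σ′ : Subst {S}} {x : Var} → (∀ z → z ≢ x → σ z ≡ σ′ z)
    → (y : Var) (t : Term S) → ∀ z → z ≢ x → (σ [ y ↦ t ]) z ≡ (σ′ [ y ↦ t ]) z
  ↦-cong agree y t z z≢x with z ≟ y
  ... | yes _ = refl
  ... | no _ = agree z z≢x

  ⇒ʳ-here : (ρ : Ren {S}) (y w : Var) → _[_⇒_]ʳ {S} ρ y w y ≡ w
  ⇒ʳ-here ρ y w with y ≟ y
  ... | yes _ = refl
  ... | no y≢y = contradiction refl y≢y

  ⇒ʳ-there : (ρ : Ren {S}) {y z : Var} (w : Var) → z ≢ y → _[_⇒_]ʳ {S} ρ y w z ≡ ρ z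
  ⇒ʳ-there ρ {y} {z} w z≢y with z ≟ y
  ... | yes z≡y = contradiction z≡y z≢y
  ... | no _ = refl

  OccT-var : ∀ {v w} → OccT {S} v (var w) → v ≡ w
  OccT-var here = refl

  var-freeFor : (x : Var) (φ : Formula S) → FreeFor (var x) x φ
  var-freeFor x ⊥F = _
  var-freeFor x ⊤F = _
  var-freeFor x (a ≐ b) = _
  var-freeFor x (rel r ts) = _
  var-freeFor x (¬F φ) = var-freeFor x φ
  var-freeFor x (φ ∧F ψ) = var-freeFor x φ , var-freeFor x ψ
  var-freeFor x (φ ∨F ψ) = var-freeFor x φ , var-freeFor x ψ
  var-freeFor x (∀F y φ) with x ≟ y
  ... | yes x≡y = inj₁ x≡y
  ... | no x≢y = inj₂ ((λ _ o → x≢y (sym (OccT-var o))) , var-freeFor x φ)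
  var-freeFor x (∃F y φ) with x ≟ y
  ... | yes x≡y = inj₁ x≡y
  ... | no x≢y = inj₂ ((λ _ o → x≢y (sym (OccT-var o))) , var-freeFor x φ)

  mkSub-lookup : ∀ {n} (xs : Vec Var n) (ts : Vec (Term S) n) → Injective _≡_ _≡_ (lookup xs)
    → ∀ i → mkSub xs ts (lookup xs i) ≡ lookup ts i
  mkSub-lookup (x ∷ xs) (t ∷ ts) inj zero with x ≟ x
  ... | yes _ = refl
  ... | no x≢x = contradiction refl x≢x
  mkSub-lookup (x ∷ xs) (t ∷ ts) inj (suc i) with lookup xs i ≟ x
  ... | yes xᵢ≡x with () ← inj {suc i} {zero} xᵢ≡x
  ... | no _ = mkSub-lookup xs ts (λ e → suc-injective (inj e)) i

  mkSub-update : ∀ {n} (xs : Vec Var n) (ts : Vec (Term S) n) (i : Fin n) (t′ : Term S)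
    → ∀ z → z ≢ lookup xs i → mkSub xs ts z ≡ mkSub xs (ts [ i ]≔ t′) z
  mkSub-update (x ∷ xs) (t ∷ ts) zero t′ z z≢x with z ≟ x
  ... | yes z≡x = contradiction z≡x z≢x
  ... | no _ = refl
  mkSub-update (x ∷ xs) (t ∷ ts) (suc i) t′ z z≢xᵢ with z ≟ x
  ... | yes _ = refl
  ... | no _ = mkSub-update xs ts i t′ z z≢xᵢ

  mutual
    OccT⇒≤maxT : ∀ {v} (t : Term S) → OccT v t → v ≤ maxT t
    OccT⇒≤maxT (var _) here = ≤-refl
    OccT⇒≤maxT (app f ts) (inApp o) = Any-OccT⇒≤maxTs ts o

    Any-OccT⇒≤maxTs : ∀ {n v} (ts : Vec (Term S) n) → Any (OccT v) ts → v ≤ maxTs ts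
    Any-OccT⇒≤maxTs (t ∷ ts) (here o) = m≤n⇒m≤n⊔o _ (OccT⇒≤maxT t o)
    Any-OccT⇒≤maxTs (t ∷ ts) (there o) = m≤n⇒m≤o⊔n _ (Any-OccT⇒≤maxTs ts o)

  FreeIn⇒≤maxF : ∀ {z} (φ : Formula S) → FreeIn z φ → z ≤ maxF φ
  FreeIn⇒≤maxF (a ≐ b) (inj₁ o) = m≤n⇒m≤n⊔o _ (OccT⇒≤maxT a o)
  FreeIn⇒≤maxF (a ≐ b) (inj₂ o) = m≤n⇒m≤o⊔n _ (OccT⇒≤maxT b o)
  FreeIn⇒≤maxF (rel r ts) o = Any-OccT⇒≤maxTs ts o
  FreeIn⇒≤maxF (¬F φ) o = FreeIn⇒≤maxF φ o
  FreeIn⇒≤maxF (φ ∧F ψ) (inj₁ o) = m≤n⇒m≤n⊔o _ (FreeIn⇒≤maxF φ o)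
  FreeIn⇒≤maxF (φ ∧F ψ) (inj₂ o) = m≤n⇒m≤o⊔n _ (FreeIn⇒≤maxF ψ o)
  FreeIn⇒≤maxF (φ ∨F ψ) (inj₁ o) = m≤n⇒m≤n⊔o _ (FreeIn⇒≤maxF φ o)
  FreeIn⇒≤maxF (φ ∨F ψ) (inj₂ o) = m≤n⇒m≤o⊔n _ (FreeIn⇒≤maxF ψ o)
  FreeIn⇒≤maxF (∀F y φ) (_ , o) = m≤n⇒m≤o⊔n _ (FreeIn⇒≤maxF φ o)
  FreeIn⇒≤maxF (∃F y φ) (_ , o) = m≤n⇒m≤o⊔n _ (FreeIn⇒≤maxF φ o)

open Syntax

module Semantics {S : Signature} (M : Structure {S}) where

  open ≡-Reasoning

  ≔ᵃ-here : (ν : Assign M) (y : Var) (d : D M) → _[_≔ᵃ_] M ν y d y ≡ d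
  ≔ᵃ-here ν y d with y ≟ y
  ... | yes _ = refl
  ... | no y≢y = contradiction refl y≢y

  ≔ᵃ-there : (ν : Assign M) {y z : Var} (d : D M) → z ≢ y → _[_≔ᵃ_] M ν y d z ≡ ν z
  ≔ᵃ-there ν {y} {z} d z≢y with z ≟ y
  ... | yes z≡y = contradiction z≡y z≢y
  ... | no _ = refl

  >>=ᵐ-funI-cong : ∀ f {m m′ : Maybe (Vec (D M) (funAr S f))}
    → m ≡ m′ → _>>=ᵐ_ M m (funI M f) ≡ _>>=ᵐ_ M m′ (funI M f)
  >>=ᵐ-funI-cong f = cong (λ m → _>>=ᵐ_ M m (funI M f))

  >>=ᵐ-∷-cong : ∀ {n} {a a′ : Maybe (D M)} {b b′ : Maybe (Vec (D M) n)} → a ≡ a′ → b ≡ b′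
    → _>>=ᵐ_ M a (λ d → _>>=ᵐ_ M b (λ ds → just (d ∷ ds)))
      ≡ _>>=ᵐ_ M a′ (λ d → _>>=ᵐ_ M b′ (λ ds → just (d ∷ ds)))
  >>=ᵐ-∷-cong refl refl = refl

  mutual
    evalT-cong : ∀ {ν ν′ : Assign M} (t : Term S)
      → (∀ z → OccT z t → ν z ≡ ν′ z) → evalT M ν t ≡ evalT M ν′ t
    evalT-cong (var x) agree = cong just (agree x here)
    evalT-cong (con c) agree = refl
    evalT-cong (app f ts) agree = >>=ᵐ-funI-cong f (evalTs-cong ts (λ z o → agree z (inApp o)))

    evalTs-cong : ∀ {n} {ν ν′ : Assign M} (ts : Vec (Term S) n)
      → (∀ z → Any (OccT z) ts → ν z ≡ ν′ z) → evalTs M ν ts ≡ evalTs M ν′ ts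
    evalTs-cong [] agree = refl
    evalTs-cong (t ∷ ts) agree =
      >>=ᵐ-∷-cong (evalT-cong t (λ z o → agree z (here o))) (evalTs-cong ts (λ z o → agree z (there o)))

  evalT-≔ᵃ-fresh : ∀ (ν : Assign M) {y} (d : D M) (t : Term S)
    → ¬ OccT y t → evalT M (_[_≔ᵃ_] M ν y d) t ≡ evalT M ν t
  evalT-≔ᵃ-fresh ν d t y∉t = evalT-cong t (λ z o → ≔ᵃ-there ν d (λ { refl → y∉t o }))

  mutual
    evalT-subT-cong : ∀ (ν : Assign M) {σ σ′ : Subst {S}} (t : Term S)
      → (∀ z → OccT z t → evalT M ν (σ z) ≡ evalT M ν (σ′ z))
      → evalT M ν (subT σ t) ≡ evalT M ν (subT σ′ t)
    evalT-subT-cong ν (var x) agree = agree x here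
    evalT-subT-cong ν (con c) agree = refl
    evalT-subT-cong ν (app f ts) agree =
      >>=ᵐ-funI-cong f (evalTs-subTs-cong ν ts (λ z o → agree z (inApp o)))

    evalTs-subTs-cong : ∀ {n} (ν : Assign M) {σ σ′ : Subst {S}} (ts : Vec (Term S) n)
      → (∀ z → Any (OccT z) ts → evalT M ν (σ z) ≡ evalT M ν (σ′ z))
      → evalTs M ν (subTs σ ts) ≡ evalTs M ν (subTs σ′ ts)
    evalTs-subTs-cong ν [] agree = refl
    evalTs-subTs-cong ν (t ∷ ts) agree =
      >>=ᵐ-∷-cong (evalT-subT-cong ν t (λ z o → agree z (here o)))
                  (evalTs-subTs-cong ν ts (λ z o → agree z (there o)))

  mutual
    evalT-subT-renT : ∀ {ν μ : Assign M} (σ : Subst {S}) (ρ : Ren {S}) (t : Term S)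
      → (∀ z → OccT z t → evalT M ν (σ (ρ z)) ≡ just (μ z))
      → evalT M ν (subT σ (renT ρ t)) ≡ evalT M μ t
    evalT-subT-renT σ ρ (var x) track = track x here
    evalT-subT-renT σ ρ (con c) track = refl
    evalT-subT-renT σ ρ (app f ts) track =
      >>=ᵐ-funI-cong f (evalTs-subTs-renTs σ ρ ts (λ z o → track z (inApp o)))

    evalTs-subTs-renTs : ∀ {n} {ν μ : Assign M} (σ : Subst {S}) (ρ : Ren {S}) (ts : Vec (Term S) n)
      → (∀ z → Any (OccT z) ts → evalT M ν (σ (ρ z)) ≡ just (μ z))
      → evalTs M ν (subTs σ (renTs ρ ts)) ≡ evalTs M μ ts
    evalTs-subTs-renTs σ ρ [] track = refl
    evalTs-subTs-renTs σ ρ (t ∷ ts) track =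
      >>=ᵐ-∷-cong (evalT-subT-renT σ ρ t (λ z o → track z (here o)))
                  (evalTs-subTs-renTs σ ρ ts (λ z o → track z (there o)))

  lookup-evalTs : ∀ {n} {ν : Assign M} (ts : Vec (Term S) n) {ds : Vec (D M) n}
    → evalTs M ν ts ≡ just ds → ∀ j → evalT M ν (lookup ts j) ≡ just (lookup ds j)
  lookup-evalTs {ν = ν} (t ∷ ts) e j with evalT M ν t in et | evalTs M ν ts in ets
  lookup-evalTs (t ∷ ts) {d ∷ ds} refl zero | just d | just ds = et
  lookup-evalTs (t ∷ ts) {d ∷ ds} refl (suc j) | just d | just ds = lookup-evalTs ts ets j

  ≐-sameValue : ∀ {ν : Assign M} (a b : Term S) → IsT M (a ≐ b) ν → evalT M ν a ≡ evalT M ν b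
  ≐-sameValue a b (d , e , ea , eb , d≡e) = trans ea (trans (cong just d≡e) (sym eb))

  record Transfers (φ : Formula S) (ν : Assign M) (ψ : Formula S) (μ : Assign M) : Set where
    constructor _,_
    field
      onT : IsT M φ ν → IsT M ψ μ
      onF : IsF M φ ν → IsF M ψ μ

  transfer-≐ : ∀ {ν μ a b a′ b′} → evalT M ν a ≡ evalT M μ a′ → evalT M ν b ≡ evalT M μ b′
    → Transfers (a ≐ b) ν (a′ ≐ b′) μ
  transfer-≐ ea eb =
      (λ { (d , e , p , q , r) → d , e , trans (sym ea) p , trans (sym eb) q , r })
    , (λ { (d , e , p , q , r) → d , e , trans (sym ea) p , trans (sym eb) q , r })

  transfer-rel : ∀ {ν μ} r {ts us} → evalTs M ν ts ≡ evalTs M μ us → Transfers (rel r ts) ν (rel r us) μ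
  transfer-rel r e =
      (λ { (ds , p , q) → ds , trans (sym e) p , q })
    , (λ { (ds , p , q) → ds , trans (sym e) p , q })

  transfer-¬F : ∀ {φ ν ψ μ} → Transfers φ ν ψ μ → Transfers (¬F φ) ν (¬F ψ) μ
  transfer-¬F (t , f) = f , t

  transfer-∧F : ∀ {φ φ′ ν ψ ψ′ μ} → Transfers φ ν ψ μ → Transfers φ′ ν ψ′ μ
    → Transfers (φ ∧F φ′) ν (ψ ∧F ψ′) μ
  transfer-∧F (t , f) (t′ , f′) =
    (λ { (p , p′) → t p , t′ p′ }) , (λ { (inj₁ p) → inj₁ (f p) ; (inj₂ p′) → inj₂ (f′ p′) })

  transfer-∨F : ∀ {φ φ′ ν ψ ψ′ μ} → Transfers φ ν ψ μ → Transfers φ′ ν ψ′ μ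
    → Transfers (φ ∨F φ′) ν (ψ ∨F ψ′) μ
  transfer-∨F (t , f) (t′ , f′) =
    (λ { (inj₁ p) → inj₁ (t p) ; (inj₂ p′) → inj₂ (t′ p′) }) , (λ { (p , p′) → f p , f′ p′ })

  transfer-∀F : ∀ {y z φ ν ψ μ}
    → (∀ d → Transfers φ (_[_≔ᵃ_] M ν y d) ψ (_[_≔ᵃ_] M μ z d))
    → Transfers (∀F y φ) ν (∀F z ψ) μ
  transfer-∀F tr = (λ p d → Transfers.onT (tr d) (p d)) , (λ { (d , p) → d , Transfers.onF (tr d) p })

  transfer-∃F : ∀ {y z φ ν ψ μ}
    → (∀ d → Transfers φ (_[_≔ᵃ_] M ν y d) ψ (_[_≔ᵃ_] M μ z d))
    → Transfers (∃F y φ) ν (∃F z ψ) μ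
  transfer-∃F tr = (λ { (d , p) → d , Transfers.onT (tr d) p }) , (λ p d → Transfers.onF (tr d) (p d))

  replace-atom : ∀ (ν : Assign M) {x t t′} {σ σ′ : Subst {S}} (Occ : Var → Set)
    → (∀ z → z ≢ x → σ z ≡ σ′ z) → σ x ≡ t → σ′ x ≡ t′
    → (Occ x → evalT M ν t ≡ evalT M ν t′)
    → ∀ z → Occ z → evalT M ν (σ z) ≡ evalT M ν (σ′ z)
  replace-atom ν {x} Occ agree σx σ′x same z o with z ≟ x
  ... | yes refl = trans (cong (evalT M ν) σx) (trans (same o) (cong (evalT M ν) (sym σ′x)))
  ... | no z≢x = cong (evalT M ν) (agree z z≢x)

  mutual
    subF-replace : ∀ (φ : Formula S) {x t t′} (σ σ′ : Subst {S}) (ν : Assign M)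
      → (∀ z → z ≢ x → σ z ≡ σ′ z) → σ x ≡ t → σ′ x ≡ t′
      → FreeFor t x φ → FreeFor t′ x φ
      → (FreeIn x φ → evalT M ν t ≡ evalT M ν t′)
      → Transfers (subF σ φ) ν (subF σ′ φ) ν
    subF-replace ⊥F σ σ′ ν _ _ _ _ _ _ = id , id
    subF-replace ⊤F σ σ′ ν _ _ _ _ _ _ = id , id
    subF-replace (a ≐ b) σ σ′ ν agree σx σ′x _ _ same =
      transfer-≐ (evalT-subT-cong ν a (λ z o → replaced z (inj₁ o)))
                 (evalT-subT-cong ν b (λ z o → replaced z (inj₂ o)))
      where
        replaced : ∀ z → OccT z a ⊎ OccT z b → evalT M ν (σ z) ≡ evalT M ν (σ′ z)
        replaced = replace-atom ν (λ z → OccT z a ⊎ OccT z b) agree σx σ′x same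
    subF-replace (rel r ts) σ σ′ ν agree σx σ′x _ _ same =
      transfer-rel r (evalTs-subTs-cong ν ts (replace-atom ν (λ z → Any (OccT z) ts) agree σx σ′x same))
    subF-replace (¬F φ) σ σ′ ν agree σx σ′x ff ff′ same =
      transfer-¬F (subF-replace φ σ σ′ ν agree σx σ′x ff ff′ same)
    subF-replace (φ ∧F ψ) σ σ′ ν agree σx σ′x (ff , gg) (ff′ , gg′) same =
      transfer-∧F (subF-replace φ σ σ′ ν agree σx σ′x ff ff′ (λ o → same (inj₁ o)))
                  (subF-replace ψ σ σ′ ν agree σx σ′x gg gg′ (λ o → same (inj₂ o)))
    subF-replace (φ ∨F ψ) σ σ′ ν agree σx σ′x (ff , gg) (ff′ , gg′) same =
      transfer-∨F (subF-replace φ σ σ′ ν agree σx σ′x ff ff′ (λ o → same (inj₁ o)))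
                  (subF-replace ψ σ σ′ ν agree σx σ′x gg gg′ (λ o → same (inj₂ o)))
    subF-replace (∀F y φ) σ σ′ ν agree σx σ′x ff ff′ same =
      transfer-∀F (replace-under y φ σ σ′ ν agree σx σ′x ff ff′ same)
    subF-replace (∃F y φ) σ σ′ ν agree σx σ′x ff ff′ same =
      transfer-∃F (replace-under y φ σ σ′ ν agree σx σ′x ff ff′ same)

    -- A binder capturing x stops the replacement: below it both sides
    -- substitute var x for x.
    replace-under : ∀ y (φ : Formula S) {x t t′} (σ σ′ : Subst {S}) (ν : Assign M)
      → (∀ z → z ≢ x → σ z ≡ σ′ z) → σ x ≡ t → σ′ x ≡ t′
      → x ≡ y ⊎ ((FreeIn x φ → ¬ OccT y t) × FreeFor t x φ)
      → x ≡ y ⊎ ((FreeIn x φ → ¬ OccT y t′) × FreeFor t′ x φ)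
      → (x ≢ y × FreeIn x φ → evalT M ν t ≡ evalT M ν t′)
      → ∀ d → Transfers (subF (σ [ y ↦ var y ]) φ) (_[_≔ᵃ_] M ν y d)
                        (subF (σ′ [ y ↦ var y ]) φ) (_[_≔ᵃ_] M ν y d)
    replace-under y φ {x} {t} {t′} σ σ′ ν agree σx σ′x ff ff′ same d with x ≟ y
    ... | yes refl =
      subF-replace φ _ _ _ (↦-cong agree y (var y)) (↦-here σ y (var y)) (↦-here σ′ y (var y))
        (var-freeFor y φ) (var-freeFor y φ) (λ _ → refl)
    ... | no x≢y =
      subF-replace φ _ _ _ (↦-cong agree y (var y))
        (trans (↦-there σ (var y) x≢y) σx) (trans (↦-there σ′ (var y) x≢y) σ′x)
        (proj₂ avoids) (proj₂ avoids′) same′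
      where
        avoids : (FreeIn x φ → ¬ OccT y t) × FreeFor t x φ
        avoids = fromInj₂ (λ x≡y → contradiction x≡y x≢y) ff
        avoids′ : (FreeIn x φ → ¬ OccT y t′) × FreeFor t′ x φ
        avoids′ = fromInj₂ (λ x≡y → contradiction x≡y x≢y) ff′
        same′ : FreeIn x φ → evalT M (_[_≔ᵃ_] M ν y d) t ≡ evalT M (_[_≔ᵃ_] M ν y d) t′
        same′ x∈φ = begin
          evalT M (_[_≔ᵃ_] M ν y d) t   ≡⟨ evalT-≔ᵃ-fresh ν d t (proj₁ avoids x∈φ) ⟩
          evalT M ν t                   ≡⟨ same (x≢y , x∈φ) ⟩
          evalT M ν t′                  ≡⟨ sym (evalT-≔ᵃ-fresh ν d t′ (proj₁ avoids′ x∈φ)) ⟩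
          evalT M (_[_≔ᵃ_] M ν y d) t′  ∎

  -- A variable z free under the
  -- current binders is renamed to w with image u; capture is excluded as
  -- long as no other binder's new name y + N is w or occurs in u.
  Apart : ℕ → Var → Var → Term S → Set
  Apart N z w u = ∀ y → z ≢ y → w ≢ y + N × ¬ OccT (y + N) u

  apart-below : ∀ {N z w u} → w < N → (∀ v → OccT v u → v < N) → Apart N z w u
  apart-below {N} w<N u<N y _ =
      (λ { refl → m+n≮n y N w<N })
    , (λ o → m+n≮n y N (u<N _ o))

  apart-renamed : ∀ N y → Apart N y (y + N) (var (y + N))
  apart-renamed N y y′ y≢y′ =
      (λ e → y≢y′ (+-cancelʳ-≡ N y y′ e))
    , (λ o → y≢y′ (+-cancelʳ-≡ N y y′ (sym (OccT-var o))))

  Tracks : ℕ → Subst {S} → Ren {S} → Assign M → Assign M → Var → Set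
  Tracks N σ ρ ν μ z = evalT M ν (σ (ρ z)) ≡ just (μ z) × Apart N z (ρ z) (σ (ρ z))

  module Binder (N : ℕ) (y : Var) (σ : Subst {S}) (ρ : Ren {S}) (ν μ : Assign M) (d : D M) where
    σ₁ : Subst {S}
    σ₁ = σ [ y + N ↦ var (y + N) ]

    ρ₁ : Ren {S}
    ρ₁ = _[_⇒_]ʳ {S} ρ y (y + N)

    ν₁ μ₁ : Assign M
    ν₁ = _[_≔ᵃ_] M ν (y + N) d
    μ₁ = _[_≔ᵃ_] M μ y d

    tracks-bound : Tracks N σ₁ ρ₁ ν₁ μ₁ y
    tracks-bound = value , subst₂ (Apart N y) (sym renamed) (sym image) (apart-renamed N y)
      where
        renamed : ρ₁ y ≡ y + N
        renamed = ⇒ʳ-here {S} ρ y (y + N)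
        image : σ₁ (ρ₁ y) ≡ var (y + N)
        image = trans (cong σ₁ renamed) (↦-here σ (y + N) (var (y + N)))
        value : evalT M ν₁ (σ₁ (ρ₁ y)) ≡ just (μ₁ y)
        value = begin
          evalT M ν₁ (σ₁ (ρ₁ y))  ≡⟨ cong (evalT M ν₁) image ⟩
          just (ν₁ (y + N))       ≡⟨ cong just (≔ᵃ-here ν (y + N) d) ⟩
          just d                  ≡⟨ cong just (sym (≔ᵃ-here μ y d)) ⟩
          just (μ₁ y)             ∎

    tracks-other : ∀ {z} → z ≢ y → Tracks N σ ρ ν μ z → Tracks N σ₁ ρ₁ ν₁ μ₁ z
    tracks-other {z} z≢y (value , apart) = value₁ , subst₂ (Apart N z) (sym renamed) (sym image) apart
      where
        renamed : ρ₁ z ≡ ρ z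
        renamed = ⇒ʳ-there {S} ρ (y + N) z≢y
        image : σ₁ (ρ₁ z) ≡ σ (ρ z)
        image = trans (cong σ₁ renamed) (↦-there σ (var (y + N)) (proj₁ (apart y z≢y)))
        value₁ : evalT M ν₁ (σ₁ (ρ₁ z)) ≡ just (μ₁ z)
        value₁ = begin
          evalT M ν₁ (σ₁ (ρ₁ z))  ≡⟨ cong (evalT M ν₁) image ⟩
          evalT M ν₁ (σ (ρ z))    ≡⟨ evalT-≔ᵃ-fresh ν d (σ (ρ z)) (proj₂ (apart y z≢y)) ⟩
          evalT M ν (σ (ρ z))     ≡⟨ value ⟩
          just (μ z)              ≡⟨ cong just (sym (≔ᵃ-there μ d z≢y)) ⟩
          just (μ₁ z)             ∎

    tracks-under : ∀ (φ : Formula S) → (∀ z → z ≢ y × FreeIn z φ → Tracks N σ ρ ν μ z)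
      → ∀ z → FreeIn z φ → Tracks N σ₁ ρ₁ ν₁ μ₁ z
    tracks-under φ tracks z z∈φ = by-cases (z ≟ y)
      where
        by-cases : Dec (z ≡ y) → Tracks N σ₁ ρ₁ ν₁ μ₁ z
        by-cases (yes z≡y) = subst (Tracks N σ₁ ρ₁ ν₁ μ₁) (sym z≡y) tracks-bound
        by-cases (no z≢y) = tracks-other z≢y (tracks z (z≢y , z∈φ))

  subF-renBound : ∀ N (ψ : Formula S) (σ : Subst {S}) (ρ : Ren {S}) (ν μ : Assign M)
    → (∀ z → FreeIn z ψ → Tracks N σ ρ ν μ z)
    → Transfers (subF σ (renBound N ρ ψ)) ν ψ μ
  subF-renBound N ⊥F σ ρ ν μ _ = id , id
  subF-renBound N ⊤F σ ρ ν μ _ = id , id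
  subF-renBound N (a ≐ b) σ ρ ν μ tracks =
    transfer-≐ (evalT-subT-renT σ ρ a (λ z o → proj₁ (tracks z (inj₁ o))))
               (evalT-subT-renT σ ρ b (λ z o → proj₁ (tracks z (inj₂ o))))
  subF-renBound N (rel r ts) σ ρ ν μ tracks =
    transfer-rel r (evalTs-subTs-renTs σ ρ ts (λ z o → proj₁ (tracks z o)))
  subF-renBound N (¬F φ) σ ρ ν μ tracks = transfer-¬F (subF-renBound N φ σ ρ ν μ tracks)
  subF-renBound N (φ ∧F ψ) σ ρ ν μ tracks =
    transfer-∧F (subF-renBound N φ σ ρ ν μ (λ z o → tracks z (inj₁ o)))
                (subF-renBound N ψ σ ρ ν μ (λ z o → tracks z (inj₂ o)))
  subF-renBound N (φ ∨F ψ) σ ρ ν μ tracks =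
    transfer-∨F (subF-renBound N φ σ ρ ν μ (λ z o → tracks z (inj₁ o)))
                (subF-renBound N ψ σ ρ ν μ (λ z o → tracks z (inj₂ o)))
  subF-renBound N (∀F y φ) σ ρ ν μ tracks =
    transfer-∀F λ d → let open Binder N y σ ρ ν μ d in
      subF-renBound N φ σ₁ ρ₁ ν₁ μ₁ (tracks-under φ tracks)
  subF-renBound N (∃F y φ) σ ρ ν μ tracks =
    transfer-∃F λ d → let open Binder N y σ ρ ν μ d in
      subF-renBound N φ σ₁ ρ₁ ν₁ μ₁ (tracks-under φ tracks)

  -- v_{k+1} ↦ d_{k+1} for k < n; the value of the other variables is junk.
  valuation : ∀ {n} → Vec (D M) n → Assign M
  valuation {n} ds k with k <? n
  ... | yes k<n = lookup ds (fromℕ< k<n)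
  ... | no _ = d₀ M

  tabulate-valuation : ∀ {n} (ds : Vec (D M) n) → tabulate (λ i → valuation ds (toℕ i)) ≡ ds
  tabulate-valuation {n} ds = trans (tabulate-cong valuation-toℕ) (tabulate∘lookup ds)
    where
      valuation-toℕ : ∀ i → valuation ds (toℕ i) ≡ lookup ds i
      valuation-toℕ i with toℕ i <? n
      ... | yes i<n = cong (lookup ds) (fromℕ<-toℕ i i<n)
      ... | no i≮n = contradiction (toℕ<n i) i≮n

  instantiate-transfers : ∀ {n} (ψ : Formula S) (ts : Vec (Term S) n) {ν : Assign M} {ds}
    → evalTs M ν ts ≡ just ds → (∀ z → FreeIn z ψ → z < n)
    → Transfers (instantiate ψ ts) ν ψ (valuation ds)
  instantiate-transfers {n} ψ ts {ν} {ds} e free = subF-renBound _ ψ (argSub ts) id ν (valuation ds) tracks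
    where
      tracks : ∀ z → FreeIn z ψ → Tracks (suc (maxF ψ ⊔ maxTs ts)) (argSub ts) id ν (valuation ds) z
      tracks z z∈ψ with z <? n
      ... | yes z<n =
          lookup-evalTs ts e (fromℕ< z<n)
        , apart-below (s≤s (m≤n⇒m≤n⊔o _ (FreeIn⇒≤maxF ψ z∈ψ)))
                      (λ v o → s≤s (m≤n⇒m≤o⊔n _ (Any-OccT⇒≤maxTs ts (lose (∈-lookup (fromℕ< z<n) ts) o))))
      ... | no z≮n = contradiction (free z z∈ψ) z≮n

  conjL⇒All : ∀ (a : Formula S) bs {ν} → IsT M (conjL a bs) ν → All (λ γ → IsT M γ ν) (a ∷ bs)
  conjL⇒All a [] h = h ∷ []
  conjL⇒All a (b ∷ bs) h with conjL⇒All (a ∧F b) bs h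
  ... | (p , q) ∷ rest = p ∷ q ∷ rest

  bigAnd⇒All : ∀ (Γ : List (Formula S)) {ν} → IsT M (bigAnd Γ) ν → All (λ γ → IsT M γ ν) Γ
  bigAnd⇒All [] h = []
  bigAnd⇒All (a ∷ as) h = conjL⇒All a as h

  module _ (Δ : Isdef {S}) (M⊨Δ : M ⊨δ Δ) where

    ⊨δ-defined : ∀ f (ds : Vec (D M) (funAr S f)) → IsT M (δ Δ f) (valuation ds) → Defined M f ds
    ⊨δ-defined f ds δ-true =
      subst (Defined M f) (tabulate-valuation ds) (proj₁ (M⊨Δ f (valuation ds)) δ-true)

    mutual
      Def⇒defined : ∀ {ν} (t : Term S) → IsT M (Def Δ t) ν → ∃ λ d → evalT M ν t ≡ just d
      Def⇒defined {ν} (var x) _ = ν x , refl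
      Def⇒defined (con c) _ = conI M c , refl
      Def⇒defined (app f ts) h
        with ++⁻ (Defs Δ ts) (bigAnd⇒All (Defs Δ ts ++ [ instantiate (δ Δ f) ts ]) h)
      ... | args , δ-inst ∷ [] with Defs⇒defined ts args
      ... | ds , eds with ⊨δ-defined f ds (Transfers.onT (instantiate-transfers (δ Δ f) ts eds (δ-free Δ f)) δ-inst)
      ... | d , fd = d , trans (>>=ᵐ-funI-cong f eds) fd

      Defs⇒defined : ∀ {n ν} (ts : Vec (Term S) n) → All (λ γ → IsT M γ ν) (Defs Δ ts)
        → ∃ λ ds → evalTs M ν ts ≡ just ds
      Defs⇒defined [] _ = [] , refl
      Defs⇒defined (t ∷ ts) (h ∷ hs) with Def⇒defined t h | Defs⇒defined ts hs
      ... | d , e | ds , es = d ∷ ds , >>=ᵐ-∷-cong e es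

open Semantics

lemma6p8 : (S : Signature) (Δ : Isdef {S})
    → ((t : Term S) → Consequence Δ (Def Δ t ∷ []) (t ≐ t))
      × ((n : ℕ) (φ : Formula S) (xs : Vec Var n)
         → Injective _≡_ _≡_ (lookup xs)
         → (i : Fin n) (ts : Vec (Term S) n) (t′ : Term S)
         → FreeFor (lookup ts i) (lookup xs i) φ
         → FreeFor t′ (lookup xs i) φ
         → Consequence Δ ((lookup ts i ≐ t′) ∷ (φ ⟪ xs ≔ ts ⟫) ∷ [])
             (φ ⟪ xs ≔ (ts [ i ]≔ t′) ⟫))
lemma6p8 S Δ =
    (λ t M M⊨Δ ν → λ { (Def-true ∷ []) →
      let (d , e) = Def⇒defined M Δ M⊨Δ t Def-true in d , d , e , e , refl })
  , (λ n φ xs inj i ts t′ ff ff′ M _ ν → λ { (tᵢ≐t′ ∷ φ-true ∷ []) →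
      Transfers.onT
        (subF-replace M φ (mkSub xs ts) (mkSub xs (ts [ i ]≔ t′)) ν
          (mkSub-update xs ts i t′)
          (mkSub-lookup xs ts inj i)
          (trans (mkSub-lookup xs (ts [ i ]≔ t′) inj i) (lookup∘update i ts t′))
          ff ff′ (λ _ → ≐-sameValue M (lookup ts i) t′ tᵢ≐t′))
        φ-true })
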